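{- Let $F=\langle W,R,S,\nu\rangle$ be a quasi-frame and $\mathcal{D}$ a finite set of formulas. If for all $w,x,y,y'\in W$, $wRxRyS_wy'$ implies $\nu(x)\subsetneq^{\mathcal{D}}_\Box\nu(y')$, then for every $w$ the relation $R;S_w$ is conversely well-founded.
   Context: Fix a logic $\mathbf{IL X}$ (basic interpretability logic extended by axiom schemata); maximal consistent sets are maximal $\mathbf{IL X}$-consistent sets. For such sets: $\Gamma\prec\Delta$ iff $\Box A\in\Gamma\Rightarrow A,\Box A\in\Delta$; $\Gamma\prec_C\Delta$ iff $A\rhd C\in\Gamma\Rightarrow\neg A,\Box\neg A\in\Delta$; $\Delta\subseteq_\Box\Delta'$ iff $\Box A\in\Delta\Rightarrow\Box A\in\Delta'$; $\Delta\subsetneq^{\mathcal{D}}_\Box\Delta'$ iff $\Delta\subseteq_\Box\Delta'$ and some $\Box A\in\mathcal{D}$ lies in $\Delta'\setminus\Delta$. A labeling $\nu$ assigns to each world a maximal consistent set and to some $R$-related pairs a formula $\nu(x,y)$. Critical cone $\mathcal{C}^C_x$: smallest set containing all $y$ with $\nu(x,y)=C$, closed under $S_x$ and $R$; generalized cone $\mathcal{G}^C_x$: smallest set containing $\mathcal{C}^C_x$ closed under $R$ and all $S_w$. A quasi-frame is $\langle W,R,S,\nu\rangle$, $S=\{S_x\}_{x\in W}$, with: $R$ conversely well-founded; $yS_xz\rightarrow xRy\wedge xRz$; $xRy\rightarrow\nu(x)\prec\nu(y)$; $A\neq B\rightarrow\mathcal{G}^A_x\cap\mathcal{G}^B_x=\varnothing$;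 $y\in\mathcal{C}^A_x\rightarrow\nu(x)\prec_A\nu(y)$. $x(R;S_w)y$ means $\exists t\,(xRt\wedge tS_wy)$; conversely well-founded means every non-empty subset has a maximal element. -}

module Defs where

open import Data.Nat using (ℕ)
open import Data.List using (List; []; _∷_)
open import Data.List.Membership.Propositional using (_∈_)
open import Data.List.Relation.Unary.All using (All)
open import Data.Maybe using (Maybe; just)
open import Data.Product using (Σ; ∃; _×_; _,_)
open import Data.Empty using (⊥)
open import Relation.Nullary using (¬_)
open import Relation.Binary.PropositionalEquality using (_≡_; _≢_)

infixr 6 _⇒_
infix 7 _▷_

data Formula : Set where
  var : ℕ → Formula
  ⊥' : Formula
  _⇒_ : Formula → Formula → Formula
  □ : Formula → Formula
  _▷_ : Formula → Formula → Formula

¬' : Formula → Formula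
¬' A = A ⇒ ⊥'

_∨'_ : Formula → Formula → Formula
A ∨' B = ¬' A ⇒ B

_∧'_ : Formula → Formula → Formula
A ∧' B = ¬' (A ⇒ ¬' B)

◇ : Formula → Formula
◇ A = ¬' (□ (¬' A))

-- The logic IL X: X is the set of all instances of the extra axiom
-- schemata.

module Logic (X : Formula → Set) where

  data ⊢_ : Formula → Set where
    ax-X  : ∀ {A} → X A → ⊢ A
    ax-K1 : ∀ {A B} → ⊢ (A ⇒ (B ⇒ A))
    ax-K2 : ∀ {A B C} → ⊢ ((A ⇒ (B ⇒ C)) ⇒ ((A ⇒ B) ⇒ (A ⇒ C)))
    ax-K3 : ∀ {A B} → ⊢ ((¬' A ⇒ ¬' B) ⇒ (B ⇒ A))
    ax-K  : ∀ {A B} → ⊢ (□ (A ⇒ B) ⇒ (□ A ⇒ □ B))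
    ax-L  : ∀ {A} → ⊢ (□ (□ A ⇒ A) ⇒ □ A)
    ax-J1 : ∀ {A B} → ⊢ (□ (A ⇒ B) ⇒ (A ▷ B))
    ax-J2 : ∀ {A B C} → ⊢ (((A ▷ B) ∧' (B ▷ C)) ⇒ (A ▷ C))
    ax-J3 : ∀ {A B C} → ⊢ (((A ▷ C) ∧' (B ▷ C)) ⇒ ((A ∨' B) ▷ C))
    ax-J4 : ∀ {A B} → ⊢ ((A ▷ B) ⇒ (◇ A ⇒ ◇ B))
    ax-J5 : ∀ {A} → ⊢ (◇ A ▷ A)
    mp    : ∀ {A B} → ⊢ (A ⇒ B) → ⊢ A → ⊢ B
    nec   : ∀ {A} → ⊢ A → ⊢ □ A

  FSet : Set₁
  FSet = Formula → Set

  _⇒*_ : List Formula → Formula → Formula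
  [] ⇒* A = A
  (B ∷ L) ⇒* A = B ⇒ (L ⇒* A)

  Consistent : FSet → Set
  Consistent Γ = ∀ (L : List Formula) → All Γ L → ¬ (⊢ (L ⇒* ⊥'))

  _∪｛_｝ : FSet → Formula → FSet
  (Γ ∪｛ A ｝) B = Γ B Data.Sum.⊎ (B ≡ A)
    where import Data.Sum

  record MCS : Set₁ where
    field
      set        : FSet
      consistent : Consistent set
      maximal    : ∀ A → Consistent (set ∪｛ A ｝) → set A
  open MCS public

  _≺_ : MCS → MCS → Set
  Γ ≺ Δ = ∀ A → set Γ (□ A) → set Δ A × set Δ (□ A)

  _≺[_]_ : MCS → Formula → MCS → Set
  Γ ≺[ C ] Δ = ∀ A → set Γ (A ▷ C) → set Δ (¬' A) × set Δ (□ (¬' A))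

  _⊆□_ : MCS → MCS → Set
  Δ ⊆□ Δ' = ∀ A → set Δ (□ A) → set Δ' (□ A)

  _⊊□[_]_ : MCS → List Formula → MCS → Set
  Δ ⊊□[ D ] Δ' = Δ ⊆□ Δ' ×
    ∃ λ A → (□ A ∈ D) × set Δ' (□ A) × ¬ set Δ (□ A)

  ConvWF : {W : Set} → (W → W → Set) → Set₁
  ConvWF {W} Q = ∀ (P : W → Set) → ∃ P →
    ∃ λ m → P m × (∀ y → P y → ¬ Q m y)

  record Structure : Set₁ where
    field
      W   : Set
      R   : W → W → Set
      S   : W → W → W → Set        -- S x y z  means  y S_x z
      ν   : W → MCS
      νR  : W → W → Maybe Formula  -- ν(x,y), partial
      νR-dom : ∀ x y C → νR x y ≡ just C → R x y

  module _ (F : Structure) where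
    open Structure F

    -- critical cone C^C_x (smallest set: inductive)
    data Crit (x : W) (C : Formula) : W → Set where
      c-base : ∀ {y} → νR x y ≡ just C → Crit x C y
      c-S    : ∀ {y z} → Crit x C y → S x y z → Crit x C z
      c-R    : ∀ {y z} → Crit x C y → R y z → Crit x C z

    data Gen (x : W) (C : Formula) : W → Set where
      g-crit : ∀ {y} → Crit x C y → Gen x C y
      g-R    : ∀ {y z} → Gen x C y → R y z → Gen x C z
      g-S    : ∀ {w y z} → Gen x C y → S w y z → Gen x C z

    R⨾S : W → W → W → Set
    R⨾S w x y = ∃ λ t → R x t × S w t y

  record IsQuasiFrame (F : Structure) : Set₁ where
    open Structure F
    field
      R-cwf   : ConvWF R
      S-R     : ∀ x y z → S x y z → R x y × R x z
      R-≺     : ∀ x y → R x y → ν x ≺ ν y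
      G-disj  : ∀ x A B → A ≢ B → ∀ y → Gen F x A y → Gen F x B y → ⊥
      C-≺     : ∀ x A y → Crit F x A y → ν x ≺[ A ] ν y

{-# OPTIONS --safe #-}
-- Every R;S_w-step y → z starts at an R-successor y of w, so by hypothesis it strictly enlarges
-- the set of boxed formulas of D that lie in the label; that number is bounded by |D|, hence
-- R;S_w has no infinite ascending chain and, classically, every non-empty set of worlds has a
-- maximal element.
module Submission where

open import Defs
open import Axiom.ExcludedMiddle using (ExcludedMiddle)
open import Level using (0ℓ)
open import Data.Nat using (ℕ; suc; _≤_; _<_; _∸_; z≤n; s≤s)
open import Data.Nat.Properties using (m≤n⇒m≤1+n; m<n⇒m<1+n; ∸-monoʳ-<)
open import Data.Nat.Induction using (<-wellFounded)
open import Data.List using (List; []; _∷_; length)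
open import Data.List.Membership.Propositional using (_∈_)
open import Data.List.Relation.Unary.Any using (here; there)
open import Data.Product using (∃; _×_; _,_; proj₂)
open import Data.Empty using (⊥-elim)
open import Function using (flip)
open import Induction.WellFounded using (Acc; acc; WellFounded)
open import Relation.Binary.Core using (Rel)
open import Relation.Nullary using (¬_; yes; no)
open import Relation.Binary.PropositionalEquality using (_≡_; refl)

module BoundedAscent {W : Set} (Q : Rel W 0ℓ) (G : W → Set) (μ : W → ℕ) (bound : ℕ)
  (successor-in-G : ∀ {x y} → Q x y → G y)
  (μ-bounded : ∀ x → μ x ≤ bound)
  (μ-increasing : ∀ {x y} → G x → Q x y → μ x < μ y)
  where

  private
    accessible-in-G : ∀ {x} → Acc _<_ (bound ∸ μ x) → G x → Acc (flip Q) x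
    accessible-in-G (acc rs) gx =
      acc λ qxy → accessible-in-G (rs (∸-monoʳ-< (μ-increasing gx qxy) (μ-bounded _))) (successor-in-G qxy)

  wellFounded : WellFounded (flip Q)
  wellFounded x = acc λ qxy → accessible-in-G (<-wellFounded _) (successor-in-G qxy)

module _ {X : Formula → Set} where
  open Logic X

  BoxIn : MCS → Formula → Set
  BoxIn Γ d = ∃ λ A → d ≡ □ A × set Γ (□ A)

module _ (em : ExcludedMiddle 0ℓ) where

  maximal-element : {W : Set} {Q : Rel W 0ℓ} → WellFounded (flip Q) →
    ∀ (P : W → Set) → ∃ P → ∃ λ m → P m × (∀ y → P y → ¬ Q m y)
  maximal-element {Q = Q} wf P (x , px) = climb (wf x) px
    where
    climb : ∀ {x} → Acc (flip Q) x → P x → ∃ λ m → P m × (∀ y → P y → ¬ Q m y)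
    climb {x} (acc rs) px with em {∃ λ y → P y × Q x y}
    ... | yes (y , py , qxy) = climb (rs qxy) py
    ... | no no-successor = x , px , λ y py qxy → no-successor (y , py , qxy)

  count : {A : Set} → (A → Set) → List A → ℕ
  count P [] = 0
  count P (x ∷ xs) with em {P x}
  ... | yes _ = suc (count P xs)
  ... | no _ = count P xs

  module _ {A : Set} {P P′ : A → Set} (P⊆P′ : ∀ {x} → P x → P′ x) where

    count-mono : ∀ xs → count P xs ≤ count P′ xs
    count-mono [] = z≤n
    count-mono (x ∷ xs) with em {P x} | em {P′ x}
    ... | yes _  | yes _  = s≤s (count-mono xs)
    ... | yes px | no ¬p′x = ⊥-elim (¬p′x (P⊆P′ px))
    ... | no _   | yes _  = m≤n⇒m≤1+n (count-mono xs)
    ... | no _   | no _   = count-mono xs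

    count-strictMono : ∀ {x xs} → x ∈ xs → P′ x → ¬ P x → count P xs < count P′ xs
    count-strictMono {x} {.x ∷ xs} (here refl) p′x ¬px with em {P x} | em {P′ x}
    ... | yes px | _      = ⊥-elim (¬px px)
    ... | no _   | yes _  = s≤s (count-mono xs)
    ... | no _   | no ¬p′x = ⊥-elim (¬p′x p′x)
    count-strictMono {x} {y ∷ xs} (there x∈xs) p′x ¬px with em {P y} | em {P′ y}
    ... | yes _  | yes _  = s≤s (count-strictMono x∈xs p′x ¬px)
    ... | yes py | no ¬p′y = ⊥-elim (¬p′y (P⊆P′ py))
    ... | no _   | yes _  = m<n⇒m<1+n (count-strictMono x∈xs p′x ¬px)
    ... | no _   | no _   = count-strictMono x∈xs p′x ¬px

  count≤length : {A : Set} (P : A → Set) → ∀ xs → count P xs ≤ length xs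
  count≤length P [] = z≤n
  count≤length P (x ∷ xs) with em {P x}
  ... | yes _ = s≤s (count≤length P xs)
  ... | no _  = m≤n⇒m≤1+n (count≤length P xs)

  module _ {X : Formula → Set} where
    open Logic X

    boxCount : MCS → List Formula → ℕ
    boxCount Γ D = count (BoxIn Γ) D

    ⊊□⇒boxCount< : ∀ {Γ Δ D} → Γ ⊊□[ D ] Δ → boxCount Γ D < boxCount Δ D
    ⊊□⇒boxCount< (Γ⊆□Δ , A , □A∈D , □A∈Δ , □A∉Γ) =
      count-strictMono (λ { (B , refl , □B∈Γ) → B , refl , Γ⊆□Δ B □B∈Γ })
        □A∈D (A , refl , □A∈Δ) λ { (.A , refl , □A∈Γ) → □A∉Γ □A∈Γ }

lemma7p6 : ExcludedMiddle 0ℓ → (X : Formula → Set) → (F : Logic.Structure X) → Logic.IsQuasiFrame X F →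
    (D : List Formula) →
    (∀ w x y y' → Logic.Structure.R F w x → Logic.Structure.R F x y → Logic.Structure.S F w y y' →
      Logic._⊊□[_]_ X (Logic.Structure.ν F x) D (Logic.Structure.ν F y')) →
    ∀ w → Logic.ConvWF X (Logic.R⨾S X F w)
lemma7p6 em X F QF D increasing w =
  maximal-element em (BoundedAscent.wellFounded (R⨾S F w) (R w) boxesOf (length D)
    R⨾S-target-in-R boxesOf-bounded boxesOf-increasing)
  where
  open Logic X
  open Structure F
  open IsQuasiFrame QF

  boxesOf : W → ℕ
  boxesOf x = boxCount em (ν x) D

  R⨾S-target-in-R : ∀ {x y} → R⨾S F w x y → R w y
  R⨾S-target-in-R (t , _ , tSwy) = proj₂ (S-R w t _ tSwy)

  boxesOf-bounded : ∀ x → boxesOf x ≤ length D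
  boxesOf-bounded x = count≤length em (BoxIn (ν x)) D

  boxesOf-increasing : ∀ {x y} → R w x → R⨾S F w x y → boxesOf x < boxesOf y
  boxesOf-increasing {x} {y} wRx (t , xRt , tSwy) =
    ⊊□⇒boxCount< em {Γ = ν x} {ν y} (increasing w x t y wRx xRt tSwy)
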